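{- Let $k\ge1$ and let $c^{(k)}_{l,m}$ ($1\le l,m\le k$) be the unique coefficients with $(xy)^{\underline{k}} = \sum_{l,m=1}^k c^{(k)}_{l,m}\, x^{\underline{l}}\, y^{\underline{m}}$ as polynomials in $x,y$. Then for every $1\le m\le k$, $c^{(k)}_{k,m}=\begin{Bmatrix} k\\ m\end{Bmatrix}$.
   Context: $x^{\underline{n}}=x(x-1)\cdots(x-n+1)$ is the falling factorial power. $\begin{Bmatrix} k\\ m\end{Bmatrix}$ is the Stirling number of the second kind (number of partitions of a $k$-element set into $m$ nonempty blocks). -}

module Defs where

open import Data.Nat using (ℕ; zero; suc)
open import Data.Integer using (ℤ; +_; _+_; _*_; _-_)

fall : ℤ → ℕ → ℤ
fall x zero    = + 1
fall x (suc n) = fall x n * (x - + n)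

stirling2 : ℕ → ℕ → ℕ
stirling2 zero    zero    = 1
stirling2 zero    (suc m) = 0
stirling2 (suc n) zero    = 0
stirling2 (suc n) (suc m) = suc m Data.Nat.* stirling2 n (suc m) Data.Nat.+ stirling2 n m

sum1 : ℕ → (ℕ → ℤ) → ℤ
sum1 zero    f = + 0
sum1 (suc k) f = sum1 k f + f (suc k)

-- Multiplying an expansion Σ_l a_l x^{\underline{l}} by (x y − K) and using
-- x^{\underline{l}} x = x^{\underline{l+1}} + l x^{\underline{l}} gives a new expansion, so by
-- induction (x y)^{\underline{k}} = Σ_{l ≤ k} b_l(y) x^{\underline{l}} with leading coefficient
-- b_k(y) = y^k; the same computation with y = 1 gives the Stirling expansion
-- y^k = Σ_m S(k,m) y^{\underline{m}}. Expansions in falling factorials are unique, since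
-- evaluating at x = 0, 1, …, n gives a triangular system with diagonal j^{\underline{j}} = j! ≠ 0.
-- Comparing coefficients of x^{\underline{k}} in the hypothesis gives
-- y^k = Σ_m c_{k,m} y^{\underline{m}} for every y, and uniqueness in y finishes the proof.
module Submission where

open import Defs
open import Data.Nat using (ℕ; _≤_)
open import Data.Integer using (ℤ; +_; _*_)
open import Relation.Binary.PropositionalEquality using (_≡_)

open import Algebra.Bundles using (AbelianGroup)
open import Data.Nat as Nat using (zero; suc; z≤n; s≤s; _<_)
import Data.Nat.Properties as ℕ
open import Data.Nat.Induction using (<-rec)
open import Data.Integer using (_+_; _-_; 0ℤ; 1ℤ; _^_; ≢-nonZero)
open import Data.Integer.Properties
  using (+-identityˡ; +-identityʳ; +-assoc; *-zeroʳ; *-comm; *-distribʳ-+;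
         +-0-abelianGroup; +-commutativeSemigroup;
         *-cancelʳ-≡; i*j≡0⇒i≡0∨j≡0; i-j≡0⇒i≡j; i≡j⇒i-j≡0; +-injective; pos-+; pos-*)
open import Data.Integer.Tactic.RingSolver using (solve-∀)
open import Data.Sum using (inj₁; inj₂)
open import Relation.Nullary using (¬_)
open import Relation.Binary.PropositionalEquality
  using (refl; sym; trans; cong; cong₂; module ≡-Reasoning)

open import Algebra.Properties.Group (AbelianGroup.group +-0-abelianGroup)
  using (∙-cancelˡ)
open import Algebra.Properties.CommutativeSemigroup +-commutativeSemigroup
  using (interchange)

sum0 : ℕ → (ℕ → ℤ) → ℤ
sum0 zero    f = f 0
sum0 (suc n) f = sum0 n f + f (suc n)

sum0-cong : ∀ n {f g : ℕ → ℤ} → (∀ i → i ≤ n → f i ≡ g i) → sum0 n f ≡ sum0 n g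
sum0-cong zero    f≗g = f≗g 0 z≤n
sum0-cong (suc n) f≗g =
  cong₂ _+_ (sum0-cong n (λ i i≤n → f≗g i (ℕ.m≤n⇒m≤1+n i≤n))) (f≗g (suc n) ℕ.≤-refl)

sum0-distrib-+ : ∀ n (f g : ℕ → ℤ) → sum0 n (λ i → f i + g i) ≡ sum0 n f + sum0 n g
sum0-distrib-+ zero    f g = refl
sum0-distrib-+ (suc n) f g =
  trans (cong (_+ (f (suc n) + g (suc n))) (sum0-distrib-+ n f g))
        (interchange (sum0 n f) (sum0 n g) (f (suc n)) (g (suc n)))

sum0-distribʳ-* : ∀ n (f : ℕ → ℤ) c → sum0 n (λ i → f i * c) ≡ sum0 n f * c
sum0-distribʳ-* zero    f c = refl
sum0-distribʳ-* (suc n) f c =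
  trans (cong (_+ f (suc n) * c) (sum0-distribʳ-* n f c))
        (sym (*-distribʳ-+ c (sum0 n f) (f (suc n))))

sum0≡head+sum1 : ∀ n (f : ℕ → ℤ) → sum0 n f ≡ f 0 + sum1 n f
sum0≡head+sum1 zero    f = sym (+-identityʳ (f 0))
sum0≡head+sum1 (suc n) f =
  trans (cong (_+ f (suc n)) (sum0≡head+sum1 n f)) (+-assoc (f 0) (sum1 n f) (f (suc n)))

sum0-vanishing-tail : ∀ {j} n (f : ℕ → ℤ) → j ≤ n → (∀ i → j < i → f i ≡ 0ℤ) →
                      sum0 n f ≡ sum0 j f
sum0-vanishing-tail zero    f z≤n _ = refl
sum0-vanishing-tail {j} (suc n) f j≤1+n tail≡0 with ℕ.m≤n⇒m<n∨m≡n j≤1+n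
... | inj₂ refl      = refl
... | inj₁ (s≤s j≤n) = begin
  sum0 n f + f (suc n) ≡⟨ cong (_+_ (sum0 n f)) (tail≡0 (suc n) (s≤s j≤n)) ⟩
  sum0 n f + 0ℤ        ≡⟨ +-identityʳ (sum0 n f) ⟩
  sum0 n f             ≡⟨ sum0-vanishing-tail n f j≤n tail≡0 ⟩
  sum0 j f             ∎
  where open ≡-Reasoning

sum0-cancel-init : ∀ n {f g : ℕ → ℤ} → (∀ i → i < n → f i ≡ g i) →
                   sum0 n f ≡ sum0 n g → f n ≡ g n
sum0-cancel-init zero    _        eq = eq
sum0-cancel-init (suc n) {f} {g} f≗g-init eq = ∙-cancelˡ (sum0 n g) (f (suc n)) (g (suc n))
  (trans (cong (_+ f (suc n)) (sym (sum0-cong n (λ i i≤n → f≗g-init i (s≤s i≤n))))) eq)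

sum1-cong : ∀ n {f g : ℕ → ℤ} → (∀ i → f (suc i) ≡ g (suc i)) → sum1 n f ≡ sum1 n g
sum1-cong zero    _    = refl
sum1-cong (suc n) f≗g = cong₂ _+_ (sum1-cong n f≗g) (f≗g n)

sum1-distribʳ-* : ∀ n (f : ℕ → ℤ) c → sum1 n (λ i → f i * c) ≡ sum1 n f * c
sum1-distribʳ-* zero    f c = refl
sum1-distribʳ-* (suc n) f c =
  trans (cong (_+ f (suc n) * c) (sum1-distribʳ-* n f c))
        (sym (*-distribʳ-+ c (sum1 n f) (f (suc n))))

shift : (ℕ → ℤ) → ℕ → ℤ
shift a zero    = 0ℤ
shift a (suc l) = a l

sum1-suc≡sum0 : ∀ n (f : ℕ → ℤ) → sum1 (suc n) f ≡ sum0 n (λ i → f (suc i))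
sum1-suc≡sum0 zero    f = +-identityˡ (f 1)
sum1-suc≡sum0 (suc n) f = cong (_+ f (suc (suc n))) (sum1-suc≡sum0 n f)

sum0-shift : ∀ n (a F : ℕ → ℤ) →
             sum0 (suc n) (λ l → shift a l * F l) ≡ sum0 n (λ l → a l * F (suc l))
sum0-shift n a F = trans (sum0≡head+sum1 (suc n) _) (trans (+-identityˡ _) (sum1-suc≡sum0 n _))

fallSum : ℕ → (ℕ → ℤ) → ℤ → ℤ
fallSum n a x = sum0 n (λ l → a l * fall x l)

VanishesAbove : ℕ → (ℕ → ℤ) → Set
VanishesAbove n a = ∀ l → n < l → a l ≡ 0ℤ

fall-vanishes : ∀ {j} l → j < l → fall (+ j) l ≡ 0ℤ
fall-vanishes {j} (suc l) (s≤s j≤l) with ℕ.m≤n⇒m<n∨m≡n j≤l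
... | inj₁ j<l  = cong (_* (+ j - + l)) (fall-vanishes l j<l)
... | inj₂ refl = trans (cong (fall (+ j) j *_) (i≡j⇒i-j≡0 {+ j} refl)) (*-zeroʳ (fall (+ j) j))

fall-nonzero : ∀ {n} k → k ≤ n → ¬ fall (+ n) k ≡ 0ℤ
fall-nonzero zero    _   ()
fall-nonzero {n} (suc k) k<n fall≡0 with i*j≡0⇒i≡0∨j≡0 (fall (+ n) k) fall≡0
... | inj₁ earlier≡0 = fall-nonzero k (ℕ.<⇒≤ k<n) earlier≡0
... | inj₂ n-k≡0     = ℕ.<⇒≢ k<n (sym (+-injective (i-j≡0⇒i≡j (+ n) (+ k) n-k≡0)))

fallSum-truncate : ∀ n a {j} → j ≤ n → fallSum n a (+ j) ≡ fallSum j a (+ j)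
fallSum-truncate n a j≤n = sum0-vanishing-tail n _ j≤n
  (λ i j<i → trans (cong (a i *_) (fall-vanishes i j<i)) (*-zeroʳ (a i)))

fallSum-coeffs-unique : ∀ n (a b : ℕ → ℤ) →
  (∀ j → j ≤ n → fallSum n a (+ j) ≡ fallSum n b (+ j)) → ∀ l → l ≤ n → a l ≡ b l
fallSum-coeffs-unique n a b agree = <-rec (λ l → l ≤ n → a l ≡ b l) step
  where
  step : ∀ l → (∀ {i} → i < l → i ≤ n → a i ≡ b i) → l ≤ n → a l ≡ b l
  step l below l≤n =
    *-cancelʳ-≡ (a l) (b l) (fall (+ l) l) {{≢-nonZero (fall-nonzero l ℕ.≤-refl)}} diagonal
    where
    open ≡-Reasoning
    agree-up-to-l : fallSum l a (+ l) ≡ fallSum l b (+ l)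
    agree-up-to-l = begin
      fallSum l a (+ l) ≡⟨ fallSum-truncate n a l≤n ⟨
      fallSum n a (+ l) ≡⟨ agree l l≤n ⟩
      fallSum n b (+ l) ≡⟨ fallSum-truncate n b l≤n ⟩
      fallSum l b (+ l) ∎
    diagonal : a l * fall (+ l) l ≡ b l * fall (+ l) l
    diagonal = sum0-cancel-init l
      (λ i i<l → cong (_* fall (+ l) i) (below i<l (ℕ.<⇒≤ (ℕ.<-≤-trans i<l l≤n))))
      agree-up-to-l

mulCoeffs : ℤ → ℤ → (ℕ → ℤ) → ℕ → ℤ
mulCoeffs y K a l = shift a l * y + a l * (y * + l - K)

fallSum-*-linear : ∀ n a x y K → VanishesAbove n a →
  fallSum n a x * (x * y - K) ≡ fallSum (suc n) (mulCoeffs y K a) x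
fallSum-*-linear n a x y K a-vanishes = begin
  fallSum n a x * (x * y - K)
    ≡⟨ sum0-distribʳ-* n (λ l → a l * fall x l) (x * y - K) ⟨
  sum0 n (λ l → a l * fall x l * (x * y - K))
    ≡⟨ sum0-cong n (λ l _ → raise (a l) (fall x l) x y K (+ l)) ⟩
  sum0 n (λ l → a l * y * fall x (suc l) + d l * fall x l)
    ≡⟨ sum0-distrib-+ n _ _ ⟩
  sum0 n (λ l → a l * y * fall x (suc l)) + fallSum n d x
    ≡⟨ cong₂ _+_ (sum0-shift n (λ l → a l * y) (fall x))
                 (sum0-vanishing-tail (suc n) _ (ℕ.n≤1+n n) d-vanishes) ⟨
  sum0 (suc n) (λ l → shift (λ i → a i * y) l * fall x l) + fallSum (suc n) d x
    ≡⟨ sum0-distrib-+ (suc n) _ _ ⟨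
  sum0 (suc n) (λ l → shift (λ i → a i * y) l * fall x l + d l * fall x l)
    ≡⟨ sum0-cong (suc n) (λ l _ → collect l) ⟩
  fallSum (suc n) (mulCoeffs y K a) x ∎
  where
  open ≡-Reasoning
  d : ℕ → ℤ
  d l = a l * (y * + l - K)
  d-vanishes : ∀ l → n < l → d l * fall x l ≡ 0ℤ
  d-vanishes l n<l = cong (λ t → t * (y * + l - K) * fall x l) (a-vanishes l n<l)
  -- x^{\underline{l+1}} = x^{\underline{l}} (x − l) is what turns this into a ring identity.
  raise : ∀ b F x y K L → b * F * (x * y - K) ≡ b * y * (F * (x - L)) + b * (y * L - K) * F
  raise = solve-∀
  shift-*ʳ : ∀ l → shift (λ i → a i * y) l ≡ shift a l * y
  shift-*ʳ zero    = refl
  shift-*ʳ (suc l) = refl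
  collect : ∀ l → shift (λ i → a i * y) l * fall x l + d l * fall x l
                  ≡ mulCoeffs y K a l * fall x l
  collect l = trans (sym (*-distribʳ-+ (fall x l) (shift (λ i → a i * y) l) (d l)))
                    (cong (λ t → (t + d l) * fall x l) (shift-*ʳ l))

mulCoeffs-vanishesAbove : ∀ n a y K → VanishesAbove n a →
                          VanishesAbove (suc n) (mulCoeffs y K a)
mulCoeffs-vanishesAbove n a y K a-vanishes (suc l) (s≤s n<l) =
  cong₂ (λ u v → u * y + v * (y * + suc l - K))
        (a-vanishes l n<l) (a-vanishes (suc l) (ℕ.m<n⇒m<1+n n<l))

mulCoeffs-leading : ∀ n a y K → VanishesAbove n a → mulCoeffs y K a (suc n) ≡ a n * y
mulCoeffs-leading n a y K a-vanishes =
  trans (cong (λ v → a n * y + v * (y * + suc n - K)) (a-vanishes (suc n) ℕ.≤-refl))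
        (+-identityʳ (a n * y))

δ₀ : ℕ → ℤ
δ₀ zero    = 1ℤ
δ₀ (suc _) = 0ℤ

fall-*-coeffs : ℤ → ℕ → ℕ → ℤ
fall-*-coeffs y zero    = δ₀
fall-*-coeffs y (suc k) = mulCoeffs y (+ k) (fall-*-coeffs y k)

fall-*-coeffs-vanishesAbove : ∀ y k → VanishesAbove k (fall-*-coeffs y k)
fall-*-coeffs-vanishesAbove y zero    (suc l) _ = refl
fall-*-coeffs-vanishesAbove y (suc k) =
  mulCoeffs-vanishesAbove k (fall-*-coeffs y k) y (+ k) (fall-*-coeffs-vanishesAbove y k)

fall-*-expansion : ∀ x y k → fall (x * y) k ≡ fallSum k (fall-*-coeffs y k) x
fall-*-expansion x y zero    = refl
fall-*-expansion x y (suc k) =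
  trans (cong (_* (x * y - + k)) (fall-*-expansion x y k))
        (fallSum-*-linear k _ x y (+ k) (fall-*-coeffs-vanishesAbove y k))

fall-*-coeffs-leading : ∀ y k → fall-*-coeffs y k k ≡ y ^ k
fall-*-coeffs-leading y zero    = refl
fall-*-coeffs-leading y (suc k) = begin
  fall-*-coeffs y (suc k) (suc k)
    ≡⟨ mulCoeffs-leading k _ y (+ k) (fall-*-coeffs-vanishesAbove y k) ⟩
  fall-*-coeffs y k k * y
    ≡⟨ cong (_* y) (fall-*-coeffs-leading y k) ⟩
  y ^ k * y
    ≡⟨ *-comm (y ^ k) y ⟩
  y ^ suc k ∎
  where open ≡-Reasoning

fall-*-leadingCoeff : ∀ k y (a : ℕ → ℤ) → (∀ x → fall (x * y) k ≡ fallSum k a x) → a k ≡ y ^ k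
fall-*-leadingCoeff k y a expansion = trans
  (sym (fallSum-coeffs-unique k (fall-*-coeffs y k) a
    (λ j _ → trans (sym (fall-*-expansion (+ j) y k)) (expansion (+ j))) k ℕ.≤-refl))
  (fall-*-coeffs-leading y k)

stirling2-vanishes : ∀ {k m} → k < m → stirling2 k m ≡ 0
stirling2-vanishes {zero}  {suc m} _ = refl
stirling2-vanishes {suc k} {suc m} (s≤s k<m)
  rewrite stirling2-vanishes (ℕ.m<n⇒m<1+n k<m) | stirling2-vanishes k<m
  = trans (ℕ.+-identityʳ (m Nat.* 0)) (ℕ.*-zeroʳ m)

stirling2-mulCoeffs : ∀ k l → mulCoeffs 1ℤ 0ℤ (λ m → + stirling2 k m) l ≡ + stirling2 (suc k) l
stirling2-mulCoeffs k zero    = trans (+-identityˡ _) (*-zeroʳ (+ stirling2 k 0))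
stirling2-mulCoeffs k (suc l) = begin
  + stirling2 k l * 1ℤ + + stirling2 k (suc l) * (1ℤ * + suc l - 0ℤ)
    ≡⟨ rearrange (+ stirling2 k l) (+ stirling2 k (suc l)) (+ suc l) ⟩
  + suc l * + stirling2 k (suc l) + + stirling2 k l
    ≡⟨ cong (_+ + stirling2 k l) (pos-* (suc l) (stirling2 k (suc l))) ⟨
  + (suc l Nat.* stirling2 k (suc l)) + + stirling2 k l
    ≡⟨ pos-+ (suc l Nat.* stirling2 k (suc l)) (stirling2 k l) ⟨
  + stirling2 (suc k) (suc l) ∎
  where
  open ≡-Reasoning
  rearrange : ∀ s t L → s * 1ℤ + t * (1ℤ * L - 0ℤ) ≡ L * t + s
  rearrange = solve-∀

^-stirling2-expansion : ∀ k y → y ^ k ≡ fallSum k (λ m → + stirling2 k m) y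
^-stirling2-expansion zero    y = refl
^-stirling2-expansion (suc k) y = begin
  y * y ^ k
    ≡⟨ cong (y *_) (^-stirling2-expansion k y) ⟩
  y * fallSum k S y
    ≡⟨ *-comm y (fallSum k S y) ⟩
  fallSum k S y * y
    ≡⟨ cong (fallSum k S y *_) (y≡y*1-0 y) ⟩
  fallSum k S y * (y * 1ℤ - 0ℤ)
    ≡⟨ fallSum-*-linear k S y 1ℤ 0ℤ S-vanishes ⟩
  fallSum (suc k) (mulCoeffs 1ℤ 0ℤ S) y
    ≡⟨ sum0-cong (suc k) (λ l _ → cong (_* fall y l) (stirling2-mulCoeffs k l)) ⟩
  fallSum (suc k) (λ m → + stirling2 (suc k) m) y ∎
  where
  open ≡-Reasoning
  S : ℕ → ℤ
  S m = + stirling2 k m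
  S-vanishes : VanishesAbove k S
  S-vanishes m k<m = cong +_ (stirling2-vanishes k<m)
  y≡y*1-0 : ∀ y → y ≡ y * 1ℤ - 0ℤ
  y≡y*1-0 = solve-∀

dropZeroth : (ℕ → ℤ) → ℕ → ℤ
dropZeroth a zero    = 0ℤ
dropZeroth a (suc l) = a (suc l)

fallSum-dropZeroth : ∀ n a x → fallSum n (dropZeroth a) x ≡ sum1 n (λ l → a l * fall x l)
fallSum-dropZeroth n a x =
  trans (sum0≡head+sum1 n _) (trans (+-identityˡ _) (sum1-cong n (λ _ → refl)))

power-expansion-from-leading-row : ∀ k (c : ℕ → ℕ → ℤ) →
  (∀ x y → fall (x * y) (suc k)
             ≡ sum1 (suc k) (λ l → sum1 (suc k) (λ m → c l m * (fall x l * fall y m)))) →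
  ∀ y → y ^ suc k ≡ sum1 (suc k) (λ m → c (suc k) m * fall y m)
power-expansion-from-leading-row k c product-expansion y =
  sym (fall-*-leadingCoeff (suc k) y (dropZeroth row) x-expansion)
  where
  open ≡-Reasoning
  row : ℕ → ℤ
  row l = sum1 (suc k) (λ m → c l m * fall y m)
  swap : ∀ u F G → u * (F * G) ≡ u * G * F
  swap = solve-∀
  factor-out : ∀ x l → sum1 (suc k) (λ m → c l m * (fall x l * fall y m)) ≡ row l * fall x l
  factor-out x l = trans (sum1-cong (suc k) (λ m → swap (c l (suc m)) (fall x l) (fall y (suc m))))
                         (sum1-distribʳ-* (suc k) (λ m → c l m * fall y m) (fall x l))
  x-expansion : ∀ x → fall (x * y) (suc k) ≡ fallSum (suc k) (dropZeroth row) x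
  x-expansion x = begin
    fall (x * y) (suc k)
      ≡⟨ product-expansion x y ⟩
    sum1 (suc k) (λ l → sum1 (suc k) (λ m → c l m * (fall x l * fall y m)))
      ≡⟨ sum1-cong (suc k) (λ l → factor-out x (suc l)) ⟩
    sum1 (suc k) (λ l → row l * fall x l)
      ≡⟨ fallSum-dropZeroth (suc k) row x ⟨
    fallSum (suc k) (dropZeroth row) x ∎

mainTheorem2 : (k : ℕ) → 1 ≤ k → (c : ℕ → ℕ → ℤ)
    → (∀ (x y : ℤ) → fall (x * y) k
         ≡ sum1 k (λ l → sum1 k (λ m → c l m * (fall x l * fall y m))))
    → ∀ (m : ℕ) → 1 ≤ m → m ≤ k → c k m ≡ + stirling2 k m
mainTheorem2 (suc k) _ c product-expansion (suc m) _ m≤k =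
  fallSum-coeffs-unique (suc k) (dropZeroth (c (suc k))) S agree (suc m) m≤k
  where
  open ≡-Reasoning
  S : ℕ → ℤ
  S l = + stirling2 (suc k) l
  agree : ∀ j → j ≤ suc k →
          fallSum (suc k) (dropZeroth (c (suc k))) (+ j) ≡ fallSum (suc k) S (+ j)
  agree j _ = begin
    fallSum (suc k) (dropZeroth (c (suc k))) (+ j)
      ≡⟨ fallSum-dropZeroth (suc k) (c (suc k)) (+ j) ⟩
    sum1 (suc k) (λ l → c (suc k) l * fall (+ j) l)
      ≡⟨ power-expansion-from-leading-row k c product-expansion (+ j) ⟨
    (+ j) ^ suc k
      ≡⟨ ^-stirling2-expansion (suc k) (+ j) ⟩
    fallSum (suc k) S (+ j) ∎
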